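{- If $G$ and $H$ are nontrivial connected graphs, then $\chi(G)+\chi(H)\le \chi_o(G\vee H)\le \chi_o(G)+\chi_o(H)$.
   Context: All graphs are finite, simple and undirected. $\chi$ denotes the ordinary chromatic number. The join $G\vee H$ is obtained from the disjoint union of $G$ and $H$ by adding all edges between $V(G)$ and $V(H)$. A proper vertex coloring $\varphi$ of a graph $G$ is called an odd coloring if for every non-isolated vertex $x$ of $G$ there is a color $c$ such that the number of neighbors $y\in N(x)$ with $\varphi(y)=c$ is odd. The odd chromatic number $\chi_o(G)$ is the minimum number of colors in an odd coloring of $G$. A graph is nontrivial if it has at least two vertices. -}

module Defs where

open import Data.Nat using (ℕ; zero; suc; _+_; _≤_; _<_; _%_)
open import Data.Fin using (Fin; splitAt; _≟_)
open import Data.Bool using (Bool; true; false; _∧_)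
open import Data.Sum using (_⊎_; inj₁; inj₂)
open import Data.Product using (Σ; ∃; ∃-syntax; _×_; _,_)
open import Relation.Binary.PropositionalEquality using (_≡_; _≢_; refl)
open import Relation.Nullary using (¬_; does)

record Graph : Set where
  field
    n     : ℕ
    adj   : Fin n → Fin n → Bool
    sym   : ∀ x y → adj x y ≡ adj y x
    loopless : ∀ x → adj x x ≡ false
open Graph public

count : ∀ {m} → (Fin m → Bool) → ℕ
count {zero} p = 0
count {suc m} p = (if p Fin.zero then 1 else 0) + count (λ i → p (Fin.suc i))
  where open import Data.Bool using (if_then_else_)
        import Data.Fin as Fin

data Reach (G : Graph) : Fin (n G) → Fin (n G) → Set where
  here : ∀ {x} → Reach G x x
  step : ∀ {x y z} → adj G x y ≡ true → Reach G y z → Reach G x z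

Connected : Graph → Set
Connected G = (1 ≤ n G) × (∀ x y → Reach G x y)

Nontrivial : Graph → Set
Nontrivial G = 2 ≤ n G

Coloring : Graph → ℕ → Set
Coloring G k = Fin (n G) → Fin k

Proper : (G : Graph) {k : ℕ} → Coloring G k → Set
Proper G φ = ∀ x y → adj G x y ≡ true → φ x ≢ φ y

NonIsolated : (G : Graph) → Fin (n G) → Set
NonIsolated G x = ∃[ y ] adj G x y ≡ true

nbrsColored : (G : Graph) {k : ℕ} → Coloring G k → Fin (n G) → Fin k → ℕ
nbrsColored G φ x c = count (λ y → adj G x y ∧ does (φ y ≟ c))

Odd : ℕ → Set
Odd m = m % 2 ≡ 1

IsOddColoring : (G : Graph) {k : ℕ} → Coloring G k → Set
IsOddColoring G φ =
  Proper G φ × (∀ x → NonIsolated G x → ∃[ c ] Odd (nbrsColored G φ x c))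

Colorable : Graph → ℕ → Set
Colorable G k = Σ (Coloring G k) (Proper G)

OddColorable : Graph → ℕ → Set
OddColorable G k = Σ (Coloring G k) (IsOddColoring G)

IsChromaticNumber : Graph → ℕ → Set
IsChromaticNumber G k = Colorable G k × (∀ j → Colorable G j → k ≤ j)

IsOddChromaticNumber : Graph → ℕ → Set
IsOddChromaticNumber G k = OddColorable G k × (∀ j → OddColorable G j → k ≤ j)

-- join G ∨ H on Fin (n G + n H): first n G vertices are G, rest are H
joinAdj : (G H : Graph) → Fin (n G + n H) → Fin (n G + n H) → Bool
joinAdj G H x y with splitAt (n G) x | splitAt (n G) y
... | inj₁ a | inj₁ b = adj G a b
... | inj₂ a | inj₂ b = adj H a b
... | inj₁ _ | inj₂ _ = true
... | inj₂ _ | inj₁ _ = true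

joinSym : (G H : Graph) → ∀ x y → joinAdj G H x y ≡ joinAdj G H y x
joinSym G H x y with splitAt (n G) x | splitAt (n G) y
... | inj₁ a | inj₁ b = sym G a b
... | inj₂ a | inj₂ b = sym H a b
... | inj₁ _ | inj₂ _ = refl
... | inj₂ _ | inj₁ _ = refl

joinLoop : (G H : Graph) → ∀ x → joinAdj G H x x ≡ false
joinLoop G H x with splitAt (n G) x
... | inj₁ a = loopless G a
... | inj₂ a = loopless H a

_∨ᴳ_ : Graph → Graph → Graph
G ∨ᴳ H = record { n = n G + n H ; adj = joinAdj G H ; sym = joinSym G H ; loopless = joinLoop G H }

{-# OPTIONS --safe #-}
module Submission where

-- In a proper colouring of G ∨ H the vertices of G and of H receive disjoint colour sets,
-- since every vertex of G is adjacent to every vertex of H. Compressing the colours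
-- used on G, and those not used on G, yields proper colourings of G and H whose sizes
-- add up to the number of colours, so χ(G) + χ(H) ≤ χ_o(G ∨ H). Conversely, colouring
-- G and H with odd colourings from disjoint palettes gives an odd colouring of G ∨ H:
-- a vertex of G sees the colours of G's palette only on its G-neighbours, exactly as in G,
-- so it keeps its odd colour. This needs every vertex to be non-isolated in its own
-- graph, which is where connectivity and nontriviality enter.

open import Defs
open import Data.Nat using (ℕ; zero; suc; _+_; _≤_; s≤s)
open import Data.Nat.Properties using (+-assoc; +-suc; +-identityʳ; +-mono-≤; ≤-trans; ≤-reflexive)
open import Data.Product using (_×_; _,_; ∃-syntax)
open import Data.Fin using (Fin; _↑ˡ_; _↑ʳ_; splitAt; join; _≟_) renaming (zero to fzero; suc to fsuc)
open import Data.Fin.Properties using (splitAt-↑ˡ; splitAt-↑ʳ; ↑ˡ-injective; ↑ʳ-injective; suc-injective; any?)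
open import Data.Bool using (Bool; true; false; _∧_; not; if_then_else_)
import Data.Sum as Sum
open import Data.Empty using (⊥-elim)
open import Function.Definitions using (Injective)
open import Relation.Nullary using (does; yes; no)
open import Relation.Nullary.Decidable using (dec-true; dec-false)
open import Relation.Binary.PropositionalEquality
  using (_≡_; _≢_; refl; trans; cong; cong₂; subst) renaming (sym to ≡-sym)
open Relation.Binary.PropositionalEquality.≡-Reasoning

data SplitView (m n : ℕ) : Fin (m + n) → Set where
  left  : (a : Fin m) → SplitView m n (a ↑ˡ n)
  right : (b : Fin n) → SplitView m n (m ↑ʳ b)

splitView : ∀ m n (z : Fin (m + n)) → SplitView m n z
splitView zero    n z = right z
splitView (suc m) n fzero = left fzero
splitView (suc m) n (fsuc z) with splitView m n z
... | left a  = left (fsuc a)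
... | right b = right b

↑ˡ≢↑ʳ : ∀ {m n} (a : Fin m) (b : Fin n) → a ↑ˡ n ≢ m ↑ʳ b
↑ˡ≢↑ʳ {m} {n} a b eq with trans (≡-sym (splitAt-↑ˡ m a n)) (trans (cong (splitAt m) eq) (splitAt-↑ʳ m n b))
... | ()

does-≟-injective : ∀ {k l} (f : Fin k → Fin l) → Injective _≡_ _≡_ f →
                   ∀ a b → does (f a ≟ f b) ≡ does (a ≟ b)
does-≟-injective f f-inj a b with a ≟ b
... | yes refl = dec-true (f a ≟ f a) refl
... | no a≢b   = dec-false (f a ≟ f b) (λ eq → a≢b (f-inj eq))

count-cong : ∀ {m} {p q : Fin m → Bool} → (∀ i → p i ≡ q i) → count p ≡ count q
count-cong {zero}          p≗q = refl
count-cong {suc m} {p} {q} p≗q rewrite p≗q fzero =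
  cong ((if q fzero then 1 else 0) +_) (count-cong (λ i → p≗q (fsuc i)))

count-false : ∀ {m} {p : Fin m → Bool} → (∀ i → p i ≡ false) → count p ≡ 0
count-false {zero}  p≗false = refl
count-false {suc m} p≗false rewrite p≗false fzero = count-false (λ i → p≗false (fsuc i))

count-++ : ∀ m n (p : Fin (m + n) → Bool) →
           count p ≡ count (λ a → p (a ↑ˡ n)) + count (λ b → p (m ↑ʳ b))
count-++ zero    n p = refl
count-++ (suc m) n p rewrite count-++ m n (λ i → p (fsuc i)) =
  ≡-sym (+-assoc (if p fzero then 1 else 0) _ _)

count-+-count-not : ∀ {m} (p : Fin m → Bool) → count p + count (λ i → not (p i)) ≡ m
count-+-count-not {zero}  p = refl
count-+-count-not {suc m} p with p fzero | count-+-count-not (λ i → p (fsuc i))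
... | true  | eq = cong suc eq
... | false | eq = trans (+-suc (count (λ i → p (fsuc i))) _) (cong suc eq)

rank : ∀ {m} (p : Fin m → Bool) (i : Fin m) → p i ≡ true → Fin (count p)
rank {suc m} p fzero    pi with p fzero
... | true = fzero
rank {suc m} p fzero () | false
rank {suc m} p (fsuc i) pi with p fzero
... | true  = fsuc (rank (λ k → p (fsuc k)) i pi)
... | false = rank (λ k → p (fsuc k)) i pi

rank-injective : ∀ {m} (p : Fin m → Bool) (i j : Fin m) (pi : p i ≡ true) (pj : p j ≡ true) →
                 rank p i pi ≡ rank p j pj → i ≡ j
rank-injective {suc m} p fzero fzero pi pj eq = refl
rank-injective {suc m} p fzero (fsuc j) pi pj eq with p fzero
rank-injective {suc m} p fzero (fsuc j) refl pj () | true
rank-injective {suc m} p fzero (fsuc j) () pj eq | false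
rank-injective {suc m} p (fsuc i) fzero pi pj eq with p fzero
rank-injective {suc m} p (fsuc i) fzero pi refl () | true
rank-injective {suc m} p (fsuc i) fzero pi () eq | false
rank-injective {suc m} p (fsuc i) (fsuc j) pi pj eq with p fzero
... | true  = cong fsuc (rank-injective (λ k → p (fsuc k)) i j pi pj (suc-injective eq))
... | false = cong fsuc (rank-injective (λ k → p (fsuc k)) i j pi pj eq)

colorable-usedColors : (G : Graph) {k : ℕ} (φ : Coloring G k) → Proper G φ →
                       (used : Fin k → Bool) → (∀ x → used (φ x) ≡ true) → Colorable G (count used)
colorable-usedColors G φ φ-proper used φ-used =
  (λ x → rank used (φ x) (φ-used x)) ,
  (λ x y xy eq → φ-proper x y xy (rank-injective used _ _ (φ-used x) (φ-used y) eq))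

connected⇒nonIsolated : (G : Graph) → Nontrivial G → Connected G → ∀ x → NonIsolated G x
connected⇒nonIsolated G (s≤s (s≤s _)) (_ , reach) x = firstStep (reach x (another x)) (another≢ x)
  where
  another : Fin (n G) → Fin (n G)
  another fzero    = fsuc fzero
  another (fsuc _) = fzero
  another≢ : ∀ x → x ≢ another x
  another≢ fzero    ()
  another≢ (fsuc _) ()
  firstStep : ∀ {x y} → Reach G x y → x ≢ y → NonIsolated G x
  firstStep here       x≢x = ⊥-elim (x≢x refl)
  firstStep (step xy _) _  = _ , xy

module Join (G H : Graph) where

  joinAdj-↑ˡ-↑ˡ : ∀ a b → joinAdj G H (a ↑ˡ n H) (b ↑ˡ n H) ≡ adj G a b
  joinAdj-↑ˡ-↑ˡ a b rewrite splitAt-↑ˡ (n G) a (n H) | splitAt-↑ˡ (n G) b (n H) = refl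

  joinAdj-↑ˡ-↑ʳ : ∀ a b → joinAdj G H (a ↑ˡ n H) (n G ↑ʳ b) ≡ true
  joinAdj-↑ˡ-↑ʳ a b rewrite splitAt-↑ˡ (n G) a (n H) | splitAt-↑ʳ (n G) (n H) b = refl

  joinAdj-↑ʳ-↑ˡ : ∀ a b → joinAdj G H (n G ↑ʳ b) (a ↑ˡ n H) ≡ true
  joinAdj-↑ʳ-↑ˡ a b rewrite splitAt-↑ˡ (n G) a (n H) | splitAt-↑ʳ (n G) (n H) b = refl

  joinAdj-↑ʳ-↑ʳ : ∀ a b → joinAdj G H (n G ↑ʳ a) (n G ↑ʳ b) ≡ adj H a b
  joinAdj-↑ʳ-↑ʳ a b rewrite splitAt-↑ʳ (n G) (n H) a | splitAt-↑ʳ (n G) (n H) b = refl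

  colorable-join-split : ∀ {j} → Colorable (G ∨ᴳ H) j →
                         ∃[ k ] ∃[ l ] Colorable G k × Colorable H l × k + l ≡ j
  colorable-join-split (θ , θ-proper) =
    count usedOnG , count (λ c → not (usedOnG c)) ,
    colorable-usedColors G φ φ-proper usedOnG φ-used ,
    colorable-usedColors H ψ ψ-proper (λ c → not (usedOnG c)) ψ-unused ,
    count-+-count-not usedOnG
    where
    φ : Coloring G _
    φ a = θ (a ↑ˡ n H)
    ψ : Coloring H _
    ψ b = θ (n G ↑ʳ b)
    φ-proper : Proper G φ
    φ-proper a a′ e = θ-proper _ _ (trans (joinAdj-↑ˡ-↑ˡ a a′) e)
    ψ-proper : Proper H ψ
    ψ-proper b b′ e = θ-proper _ _ (trans (joinAdj-↑ʳ-↑ʳ b b′) e)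
    usedOnG : Fin _ → Bool
    usedOnG c = does (any? (λ a → φ a ≟ c))
    φ-used : ∀ a → usedOnG (φ a) ≡ true
    φ-used a = dec-true (any? _) (a , refl)
    ψ-unused : ∀ b → not (usedOnG (ψ b)) ≡ true
    ψ-unused b = cong not (dec-false (any? _) (λ (a , eq) → θ-proper _ _ (joinAdj-↑ˡ-↑ʳ a b) eq))

  module Juxtaposed {c d : ℕ} (φ : Coloring G c) (ψ : Coloring H d) where

    θ : Coloring (G ∨ᴳ H) (c + d)
    θ z = join c d (Sum.map φ ψ (splitAt (n G) z))

    θ-↑ˡ : ∀ a → θ (a ↑ˡ n H) ≡ φ a ↑ˡ d
    θ-↑ˡ a rewrite splitAt-↑ˡ (n G) a (n H) = refl

    θ-↑ʳ : ∀ b → θ (n G ↑ʳ b) ≡ c ↑ʳ ψ b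
    θ-↑ʳ b rewrite splitAt-↑ʳ (n G) (n H) b = refl

    θ-proper : Proper G φ → Proper H ψ → Proper (G ∨ᴳ H) θ
    θ-proper φ-proper ψ-proper z w zw with splitView (n G) (n H) z | splitView (n G) (n H) w
    ... | left a  | left a′ = λ eq → φ-proper a a′ (trans (≡-sym (joinAdj-↑ˡ-↑ˡ a a′)) zw)
            (↑ˡ-injective d _ _ (trans (≡-sym (θ-↑ˡ a)) (trans eq (θ-↑ˡ a′))))
    ... | right b | right b′ = λ eq → ψ-proper b b′ (trans (≡-sym (joinAdj-↑ʳ-↑ʳ b b′)) zw)
            (↑ʳ-injective c _ _ (trans (≡-sym (θ-↑ʳ b)) (trans eq (θ-↑ʳ b′))))
    ... | left a  | right b = λ eq → ↑ˡ≢↑ʳ (φ a) (ψ b) (trans (≡-sym (θ-↑ˡ a)) (trans eq (θ-↑ʳ b)))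
    ... | right b | left a  = λ eq → ↑ˡ≢↑ʳ (φ a) (ψ b) (trans (≡-sym (θ-↑ˡ a)) (trans (≡-sym eq) (θ-↑ʳ b)))

    nbrsColored-↑ˡ : ∀ a col → nbrsColored (G ∨ᴳ H) θ (a ↑ˡ n H) (col ↑ˡ d) ≡ nbrsColored G φ a col
    nbrsColored-↑ˡ a col = begin
      nbrsColored (G ∨ᴳ H) θ (a ↑ˡ n H) (col ↑ˡ d) ≡⟨ count-++ (n G) (n H) seen ⟩
      count (λ a′ → seen (a′ ↑ˡ n H)) + count (λ b → seen (n G ↑ʳ b))
        ≡⟨ cong₂ _+_ (count-cong seenInG) (count-false unseenInH) ⟩
      nbrsColored G φ a col + 0                     ≡⟨ +-identityʳ _ ⟩
      nbrsColored G φ a col                         ∎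
      where
      seen : Fin (n G + n H) → Bool
      seen z = joinAdj G H (a ↑ˡ n H) z ∧ does (θ z ≟ col ↑ˡ d)
      seenInG : ∀ a′ → seen (a′ ↑ˡ n H) ≡ adj G a a′ ∧ does (φ a′ ≟ col)
      seenInG a′ rewrite joinAdj-↑ˡ-↑ˡ a a′ | θ-↑ˡ a′ =
        cong (adj G a a′ ∧_) (does-≟-injective (_↑ˡ d) (↑ˡ-injective d _ _) (φ a′) col)
      unseenInH : ∀ b → seen (n G ↑ʳ b) ≡ false
      unseenInH b rewrite joinAdj-↑ˡ-↑ʳ a b | θ-↑ʳ b =
        dec-false (c ↑ʳ ψ b ≟ col ↑ˡ d) (λ eq → ↑ˡ≢↑ʳ col (ψ b) (≡-sym eq))

    nbrsColored-↑ʳ : ∀ b col → nbrsColored (G ∨ᴳ H) θ (n G ↑ʳ b) (c ↑ʳ col) ≡ nbrsColored H ψ b col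
    nbrsColored-↑ʳ b col = begin
      nbrsColored (G ∨ᴳ H) θ (n G ↑ʳ b) (c ↑ʳ col) ≡⟨ count-++ (n G) (n H) seen ⟩
      count (λ a → seen (a ↑ˡ n H)) + count (λ b′ → seen (n G ↑ʳ b′))
        ≡⟨ cong₂ _+_ (count-false unseenInG) (count-cong seenInH) ⟩
      nbrsColored H ψ b col                         ∎
      where
      seen : Fin (n G + n H) → Bool
      seen z = joinAdj G H (n G ↑ʳ b) z ∧ does (θ z ≟ c ↑ʳ col)
      unseenInG : ∀ a → seen (a ↑ˡ n H) ≡ false
      unseenInG a rewrite joinAdj-↑ʳ-↑ˡ a b | θ-↑ˡ a = dec-false (φ a ↑ˡ d ≟ c ↑ʳ col) (↑ˡ≢↑ʳ (φ a) col)
      seenInH : ∀ b′ → seen (n G ↑ʳ b′) ≡ adj H b b′ ∧ does (ψ b′ ≟ col)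
      seenInH b′ rewrite joinAdj-↑ʳ-↑ʳ b b′ | θ-↑ʳ b′ =
        cong (adj H b b′ ∧_) (does-≟-injective (c ↑ʳ_) (↑ʳ-injective c _ _) (ψ b′) col)

  oddColorable-join : (∀ a → NonIsolated G a) → (∀ b → NonIsolated H b) → ∀ {c d} →
                      OddColorable G c → OddColorable H d → OddColorable (G ∨ᴳ H) (c + d)
  oddColorable-join G-nonIso H-nonIso (φ , φ-proper , φ-odd) (ψ , ψ-proper , ψ-odd) =
    θ , θ-proper φ-proper ψ-proper , θ-odd
    where
    open Juxtaposed φ ψ
    θ-odd : ∀ z → NonIsolated (G ∨ᴳ H) z → ∃[ col ] Odd (nbrsColored (G ∨ᴳ H) θ z col)
    θ-odd z _ with splitView (n G) (n H) z
    ... | left a with φ-odd a (G-nonIso a)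
    ...   | col , odd = col ↑ˡ _ , subst Odd (≡-sym (nbrsColored-↑ˡ a col)) odd
    θ-odd z _ | right b with ψ-odd b (H-nonIso b)
    ...   | col , odd = _ ↑ʳ col , subst Odd (≡-sym (nbrsColored-↑ʳ b col)) odd

open Join

mainTheorem6 : (G H : Graph) → Nontrivial G → Connected G → Nontrivial H → Connected H →
    (a b c d j : ℕ) → IsChromaticNumber G a → IsChromaticNumber H b →
    IsOddChromaticNumber G c → IsOddChromaticNumber H d →
    IsOddChromaticNumber (G ∨ᴳ H) j →
    (a + b ≤ j) × (j ≤ c + d)
mainTheorem6 G H G-nt G-conn H-nt H-conn a b c d j (_ , χG-min) (_ , χH-min) (G-odd , _) (H-odd , _)
             ((θ , θ-proper , _) , χoJoin-min) = lower , upper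
  where
  lower : a + b ≤ j
  lower with colorable-join-split G H (θ , θ-proper)
  ... | k , l , G-col , H-col , k+l≡j =
    ≤-trans (+-mono-≤ (χG-min k G-col) (χH-min l H-col)) (≤-reflexive k+l≡j)
  upper : j ≤ c + d
  upper = χoJoin-min (c + d)
    (oddColorable-join G H (connected⇒nonIsolated G G-nt G-conn) (connected⇒nonIsolated H H-nt H-conn)
       G-odd H-odd)
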